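{- Let $m\ge 3$, let $d$ be an integer with $d^2\equiv 1\pmod{2^m-1}$, let $\alpha_1,\alpha_2,\alpha_3\in\mathbb{F}_{2^m}^*$ be pairwise distinct with $\alpha_i^{d+1}=1$ for $i=1,2,3$, and suppose $\alpha_4=\alpha_1+\alpha_2+\alpha_3$ satisfies $\alpha_4^{d+1}=1$. For $i=1,2,3,4$ let $\pi_i(y)=\alpha_iy^d$ (these are involutions of $\mathbb{F}_{2^m}$), let $h_i(y)=\mathrm{Tr}^m_1(\beta_iy^k)$ with $k=d$ and $\beta_i=\alpha_i$, and let $f_i(x,y)=\mathrm{Tr}^m_1(x\pi_i(y))+h_i(y)$ for $x,y\in\mathbb{F}_{2^m}$. Then (i) $f_1(x,y)+f_2(x,y)+f_3(x,y)+f_4(x,y)=0$ for all $x,y$, and (ii) $h_1(\pi_1^{ -1}(y))+h_2(\pi_2^{ -1}(y))+h_3(\pi_3^{ -1}(y))+h_4(\pi_4^{ -1}(y))=0$ for all $y\in\mathbb{F}_{2^m}$.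
   Context: $\mathrm{Tr}^m_1$ denotes the absolute trace from $\mathbb{F}_{2^m}$ to $\mathbb{F}_2$. -}

module Defs where

open import Level using (Level; _⊔_)
open import Data.Nat using (ℕ; zero; suc; _^_)
open import Data.Fin using (Fin)
open import Data.Product using (Σ; _×_)
open import Relation.Nullary using (¬_)
open import Relation.Binary.PropositionalEquality using (_≡_)
open import Algebra.Bundles using (CommutativeRing)

-- A finite field with 2^m elements (i.e. a model of F_{2^m}):
-- a commutative ring that is a field, with an enumeration
-- Fin (2 ^ m) → Carrier that is a bijection up to the setoid equality.
-- (Characteristic 2 follows from the cardinality, but is recorded for clarity.)
record GF2^ (m : ℕ) (c ℓ : Level) : Set (Level.suc (c ⊔ ℓ)) where
  field
    cring : CommutativeRing c ℓ
  open CommutativeRing cring public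
  field
    1≉0      : ¬ (1# ≈ 0#)
    inverse  : ∀ x → ¬ (x ≈ 0#) → Σ Carrier (λ y → x * y ≈ 1#)
    char2    : 1# + 1# ≈ 0#
    enum     : Fin (2 ^ m) → Carrier
    enum-inj : ∀ i j → enum i ≈ enum j → i ≡ j
    enum-sur : ∀ x → Σ (Fin (2 ^ m)) (λ i → enum i ≈ x)

module FieldOps {m : ℕ} {c ℓ : Level} (F : GF2^ m c ℓ) where
  open GF2^ F

  pow : Carrier → ℕ → Carrier
  pow x zero    = 1#
  pow x (suc n) = x * pow x n

  -- absolute trace Tr^m_1(x) = Σ_{i=0}^{m-1} x^(2^i), viewed inside F_{2^m}
  -- (its values are 0# or 1#, i.e. the prime field F_2)
  trAux : ℕ → Carrier → Carrier
  trAux zero    x = 0#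
  trAux (suc i) x = pow x (2 ^ i) + trAux i x

  Tr : Carrier → Carrier
  Tr x = trAux m x

-- Frobenius makes Tr additive in characteristic 2, so f α x y = Tr (α (x + 1) y^d) is
-- additive in α, and the terms for α₁, α₂, α₃ add up to the term for α₄ = α₁ + α₂ + α₃,
-- which cancels it. For (ii), h α (π α⁻¹ y) = Tr (π α (π α⁻¹ y)) = Tr y, and four equal
-- terms cancel. The hypotheses on d and the αᵢ only guarantee that the πᵢ are
-- involutions; the proof needs nothing beyond the given right inverses gᵢ.
module Submission where

open import Defs
open import Level using (Level)
open import Data.Nat as ℕ using (ℕ; zero; suc; _≤_; _^_; _∸_)
open import Data.Nat.Divisibility using (_∣_)
open import Data.Product using (_×_; _,_)
open import Relation.Nullary using (¬_)
open import Algebra.Bundles using (CommutativeRing)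
import Algebra.Properties.CommutativeSemigroup as CommutativeSemigroupProperties
import Relation.Binary.Reasoning.Setoid as SetoidReasoning

HasCharacteristic2 : ∀ {c ℓ} → CommutativeRing c ℓ → Set ℓ
HasCharacteristic2 R = 1# + 1# ≈ 0#
  where open CommutativeRing R

module Characteristic2 {c ℓ : Level} (R : CommutativeRing c ℓ) (1+1≈0 : HasCharacteristic2 R) where

  open CommutativeRing R
  open SetoidReasoning setoid
  open CommutativeSemigroupProperties +-commutativeSemigroup using (interchange)

  x+x≈0# : ∀ x → x + x ≈ 0#
  x+x≈0# x = begin
    x + x               ≈⟨ +-cong (sym (*-identityˡ x)) (sym (*-identityˡ x)) ⟩
    1# * x + 1# * x     ≈⟨ sym (distribʳ x 1# 1#) ⟩
    (1# + 1#) * x       ≈⟨ *-congʳ 1+1≈0 ⟩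
    0# * x              ≈⟨ zeroˡ x ⟩
    0#                  ∎

  x≈y⇒x+y≈0# : ∀ {x y} → x ≈ y → x + y ≈ 0#
  x≈y⇒x+y≈0# {x} x≈y = trans (+-congˡ (sym x≈y)) (x+x≈0# x)

  x+x+x+x≈0# : ∀ x → ((x + x) + x) + x ≈ 0#
  x+x+x+x≈0# x = x≈y⇒x+y≈0# (trans (+-congʳ (x+x≈0# x)) (+-identityˡ x))

  [x+y]*[x+y]≈x*x+y*y : ∀ x y → (x + y) * (x + y) ≈ x * x + y * y
  [x+y]*[x+y]≈x*x+y*y x y = begin
    (x + y) * (x + y)                  ≈⟨ distribʳ (x + y) x y ⟩
    x * (x + y) + y * (x + y)          ≈⟨ +-cong (distribˡ x x y) (distribˡ y x y) ⟩
    (x * x + x * y) + (y * x + y * y)  ≈⟨ +-congˡ (+-comm (y * x) (y * y)) ⟩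
    (x * x + x * y) + (y * y + y * x)  ≈⟨ interchange (x * x) (x * y) (y * y) (y * x) ⟩
    (x * x + y * y) + (x * y + y * x)  ≈⟨ +-congˡ (x≈y⇒x+y≈0# (*-comm x y)) ⟩
    (x * x + y * y) + 0#               ≈⟨ +-identityʳ _ ⟩
    x * x + y * y                      ∎

module TraceProperties {m : ℕ} {c ℓ : Level} (F : GF2^ m c ℓ) where

  open GF2^ F
  open FieldOps F
  open Characteristic2 cring char2 public
  open SetoidReasoning setoid
  open CommutativeSemigroupProperties +-commutativeSemigroup using (interchange)

  pow-congˡ : ∀ n {x y} → x ≈ y → pow x n ≈ pow y n
  pow-congˡ zero    x≈y = refl
  pow-congˡ (suc n) x≈y = *-cong x≈y (pow-congˡ n x≈y)

  pow-homo-* : ∀ x a b → pow x (a ℕ.+ b) ≈ pow x a * pow x b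
  pow-homo-* x zero    b = sym (*-identityˡ _)
  pow-homo-* x (suc a) b = trans (*-congˡ (pow-homo-* x a b)) (sym (*-assoc _ _ _))

  pow-2^suc : ∀ x i → pow x (2 ^ suc i) ≈ pow x (2 ^ i) * pow x (2 ^ i)
  pow-2^suc x i = begin
    pow x (2 ^ i ℕ.+ (2 ^ i ℕ.+ 0))      ≈⟨ pow-homo-* x (2 ^ i) _ ⟩
    pow x (2 ^ i) * pow x (2 ^ i ℕ.+ 0)  ≈⟨ *-congˡ (pow-homo-* x (2 ^ i) 0) ⟩
    pow x (2 ^ i) * (pow x (2 ^ i) * 1#) ≈⟨ *-congˡ (*-identityʳ _) ⟩
    pow x (2 ^ i) * pow x (2 ^ i)        ∎

  frobenius : ∀ i x y → pow (x + y) (2 ^ i) ≈ pow x (2 ^ i) + pow y (2 ^ i)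
  frobenius zero    x y = trans (*-identityʳ _) (sym (+-cong (*-identityʳ x) (*-identityʳ y)))
  frobenius (suc i) x y = begin
    pow (x + y) (2 ^ suc i)                   ≈⟨ pow-2^suc (x + y) i ⟩
    pow (x + y) (2 ^ i) * pow (x + y) (2 ^ i) ≈⟨ *-cong (frobenius i x y) (frobenius i x y) ⟩
    (X + Y) * (X + Y)                         ≈⟨ [x+y]*[x+y]≈x*x+y*y X Y ⟩
    X * X + Y * Y                             ≈⟨ sym (+-cong (pow-2^suc x i) (pow-2^suc y i)) ⟩
    pow x (2 ^ suc i) + pow y (2 ^ suc i)     ∎
    where
    X Y : Carrier
    X = pow x (2 ^ i)
    Y = pow y (2 ^ i)

  trAux-cong : ∀ i {x y} → x ≈ y → trAux i x ≈ trAux i y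
  trAux-cong zero    x≈y = refl
  trAux-cong (suc i) x≈y = +-cong (pow-congˡ (2 ^ i) x≈y) (trAux-cong i x≈y)

  trAux-homo-+ : ∀ i x y → trAux i (x + y) ≈ trAux i x + trAux i y
  trAux-homo-+ zero    x y = sym (+-identityʳ 0#)
  trAux-homo-+ (suc i) x y =
    trans (+-cong (frobenius i x y) (trAux-homo-+ i x y)) (interchange _ _ _ _)

  Tr-cong : ∀ {x y} → x ≈ y → Tr x ≈ Tr y
  Tr-cong = trAux-cong m

  Tr-homo-+ : ∀ x y → Tr (x + y) ≈ Tr x + Tr y
  Tr-homo-+ = trAux-homo-+ m

  Tr-distribʳ : ∀ z a b → Tr ((a + b) * z) ≈ Tr (a * z) + Tr (b * z)
  Tr-distribʳ z a b = trans (Tr-cong (distribʳ z a b)) (Tr-homo-+ (a * z) (b * z))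

module MaioranaMcFarland {m : ℕ} {c ℓ : Level} (F : GF2^ m c ℓ) (d : ℕ) where

  open GF2^ F
  open FieldOps F
  open TraceProperties F
  open SetoidReasoning setoid

  π : Carrier → Carrier → Carrier
  π α y = α * pow y d

  h : Carrier → Carrier → Carrier
  h β y = Tr (β * pow y d)

  f : Carrier → Carrier → Carrier → Carrier
  f α x y = Tr (x * π α y) + h α y

  f≈Tr[α*[x+1]*y^d] : ∀ α x y → f α x y ≈ Tr (α * ((x + 1#) * pow y d))
  f≈Tr[α*[x+1]*y^d] α x y = begin
    Tr (x * (α * Y)) + Tr (α * Y)   ≈⟨ sym (Tr-homo-+ _ _) ⟩
    Tr (x * (α * Y) + α * Y)        ≈⟨ Tr-cong (+-cong (x∙yz≈y∙xz x α Y) (*-congˡ (sym (*-identityˡ Y)))) ⟩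
    Tr (α * (x * Y) + α * (1# * Y)) ≈⟨ Tr-cong (sym (distribˡ α _ _)) ⟩
    Tr (α * (x * Y + 1# * Y))       ≈⟨ Tr-cong (*-congˡ (sym (distribʳ Y x 1#))) ⟩
    Tr (α * ((x + 1#) * Y))         ∎
    where
    open CommutativeSemigroupProperties *-commutativeSemigroup using (x∙yz≈y∙xz)
    Y : Carrier
    Y = pow y d

  f-sum₄≈0# : ∀ α₁ α₂ α₃ x y →
    ((f α₁ x y + f α₂ x y) + f α₃ x y) + f ((α₁ + α₂) + α₃) x y ≈ 0#
  f-sum₄≈0# α₁ α₂ α₃ x y = begin
    ((f α₁ x y + f α₂ x y) + f α₃ x y) + f α₄ x y ≈⟨ +-cong (+-cong (+-cong (f≈T α₁) (f≈T α₂)) (f≈T α₃)) (f≈T α₄) ⟩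
    ((T α₁ + T α₂) + T α₃) + T α₄                 ≈⟨ x≈y⇒x+y≈0# (sym T-α₄) ⟩
    0#                                            ∎
    where
    α₄ : Carrier
    α₄ = (α₁ + α₂) + α₃
    z : Carrier
    z = (x + 1#) * pow y d
    T : Carrier → Carrier
    T α = Tr (α * z)
    f≈T : ∀ α → f α x y ≈ T α
    f≈T α = f≈Tr[α*[x+1]*y^d] α x y
    T-α₄ : T α₄ ≈ (T α₁ + T α₂) + T α₃
    T-α₄ = trans (Tr-distribʳ z (α₁ + α₂) α₃) (+-congʳ (Tr-distribʳ z α₁ α₂))

  h∘π⁻¹≈Tr : ∀ α {g : Carrier → Carrier} → (∀ y → π α (g y) ≈ y) → ∀ y → h α (g y) ≈ Tr y
  h∘π⁻¹≈Tr α π∘g≈id y = Tr-cong (π∘g≈id y)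

proposition4p5 : ∀ {c ℓ : Level} (m : ℕ) → 3 ≤ m → (F : GF2^ m c ℓ) →
    let open GF2^ F in let open FieldOps F in
    (d : ℕ) → 1 ≤ d → (2 ^ m ∸ 1) ∣ (d ℕ.* d ∸ 1) →
    (α₁ α₂ α₃ : Carrier) →
    ¬ (α₁ ≈ 0#) → ¬ (α₂ ≈ 0#) → ¬ (α₃ ≈ 0#) →
    ¬ (α₁ ≈ α₂) → ¬ (α₁ ≈ α₃) → ¬ (α₂ ≈ α₃) →
    pow α₁ (d ℕ.+ 1) ≈ 1# → pow α₂ (d ℕ.+ 1) ≈ 1# → pow α₃ (d ℕ.+ 1) ≈ 1# →
    pow ((α₁ + α₂) + α₃) (d ℕ.+ 1) ≈ 1# →
    let α₄ = (α₁ + α₂) + α₃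
        π : Carrier → Carrier → Carrier
        π α y = α * pow y d
        h : Carrier → Carrier → Carrier
        h β y = Tr (β * pow y d)
        f : Carrier → Carrier → Carrier → Carrier
        f α x y = Tr (x * π α y) + h α y
    in ((∀ x y → ((f α₁ x y + f α₂ x y) + f α₃ x y) + f α₄ x y ≈ 0#)
       × ((g₁ g₂ g₃ g₄ : Carrier → Carrier) →
          (∀ y → g₁ (π α₁ y) ≈ y) → (∀ y → π α₁ (g₁ y) ≈ y) →
          (∀ y → g₂ (π α₂ y) ≈ y) → (∀ y → π α₂ (g₂ y) ≈ y) →
          (∀ y → g₃ (π α₃ y) ≈ y) → (∀ y → π α₃ (g₃ y) ≈ y) →
          (∀ y → g₄ (π α₄ y) ≈ y) → (∀ y → π α₄ (g₄ y) ≈ y) →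
          ∀ y → ((h α₁ (g₁ y) + h α₂ (g₂ y)) + h α₃ (g₃ y)) + h α₄ (g₄ y) ≈ 0#))
proposition4p5 _ _ F d _ _ α₁ α₂ α₃ _ _ _ _ _ _ _ _ _ _ =
  f-sum₄≈0# α₁ α₂ α₃ ,
  λ _ _ _ _ _ π∘g₁ _ π∘g₂ _ π∘g₃ _ π∘g₄ y →
    trans (+-cong (+-cong (+-cong (h∘π⁻¹≈Tr α₁ π∘g₁ y) (h∘π⁻¹≈Tr α₂ π∘g₂ y))
                          (h∘π⁻¹≈Tr α₃ π∘g₃ y))
                  (h∘π⁻¹≈Tr ((α₁ + α₂) + α₃) π∘g₄ y))
          (x+x+x+x≈0# (Tr y))
  where
  open GF2^ F
  open FieldOps F
  open TraceProperties F
  open MaioranaMcFarland F d
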